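{- A clause $c$ of a CNF formula $F$ is superredundant in $F$ if and only if either $F \vdash c_1$ for some clause $c_1 \subsetneq c$, or there exist a variable $a$ not occurring in $c$ and clauses $c_1, c_2$ with $c = c_1 \vee c_2$ such that $F \vdash c_1 \vee a$ and $F \vdash c_2 \vee \neg a$.
   Context: A CNF formula is a finite set of clauses; a clause is a finite set of literals, read as their disjunction. Tautological clauses are not allowed. Resolution: from clauses $c_1 \vee l$ and $c_2 \vee \neg l$ derive $c_1 \vee c_2$; two clauses whose resolvent would be a tautology are considered not to resolve. The resolution closure $\mathrm{ResCn}(F)$ is the set of all clauses obtainable from $F$ by zero or more resolution steps; $F \vdash d$ means $d \in \mathrm{ResCn}(F)$. A clause $c \in F$ is superredundant in $F$ if $\mathrm{ResCn}(F) \setminus \{c\} \models c$. -}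

module Defs where

open import Data.Nat using (ℕ)
open import Data.Bool using (Bool; true; false; T; not)
open import Data.List using (List; []; _∷_; _++_)
open import Data.List.Membership.Propositional using (_∈_; _∉_)
open import Data.List.Relation.Unary.Any using (Any)
open import Data.List.Relation.Unary.All using (All)
open import Data.Product using (_×_; Σ; ∃; ∃-syntax)
open import Data.Sum using (_⊎_)
open import Relation.Binary.PropositionalEquality using (_≡_; _≢_)
open import Relation.Nullary using (¬_)
open import Function.Bundles using (_⇔_)

data Lit : Set where
  pos : ℕ → Lit
  neg : ℕ → Lit

-- A clause is a finite set of literals, represented by a list read up to
-- set equality (membership); a CNF formula is a finite set of clauses,
-- represented by a list.
Clause : Set
Clause = List Lit

CNF : Set
CNF = List Clause

_≋_ : Clause → Clause → Set
c ≋ d = ∀ l → (l ∈ c) ⇔ (l ∈ d)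

_⊆_ : Clause → Clause → Set
c ⊆ d = ∀ {l} → l ∈ c → l ∈ d

_⊊_ : Clause → Clause → Set
c ⊊ d = (c ⊆ d) × (∃[ l ] (l ∈ d × l ∉ c))

Tautology : Clause → Set
Tautology c = ∃[ a ] (pos a ∈ c × neg a ∈ c)

NonTautological : Clause → Set
NonTautological c = ¬ Tautology c

Occurs : ℕ → Clause → Set
Occurs a c = (pos a ∈ c) ⊎ (neg a ∈ c)

-- F ⊢ d : d ∈ ResCn(F).  Clauses are taken up to set equality.
-- Resolution on variable a: from d₁ ∋ a and d₂ ∋ ¬a derive
-- (d₁ ∖ {a}) ∪ (d₂ ∖ {¬a}), provided this resolvent is not a tautology.
data _⊢_ (F : CNF) : Clause → Set where
  axiom : ∀ {c d} → c ∈ F → c ≋ d → F ⊢ d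
  resolve : ∀ {d₁ d₂ d} (a : ℕ) → F ⊢ d₁ → F ⊢ d₂ →
            pos a ∈ d₁ → neg a ∈ d₂ →
            (∀ l → (l ∈ d) ⇔ ((l ∈ d₁ × l ≢ pos a) ⊎ (l ∈ d₂ × l ≢ neg a))) →
            NonTautological d →
            F ⊢ d

Assignment : Set
Assignment = ℕ → Bool

SatLit : Assignment → Lit → Set
SatLit σ (pos a) = T (σ a)
SatLit σ (neg a) = T (not (σ a))

SatClause : Assignment → Clause → Set
SatClause σ c = Any (SatLit σ) c

-- c is superredundant in F:  ResCn(F) ∖ {c} ⊨ c
-- (the hypothesis c ∈ F is part of the theorem statement).
Superredundant : CNF → Clause → Set
Superredundant F c =
  ∀ (σ : Assignment) →
    (∀ d → F ⊢ d → ¬ (d ≋ c) → SatClause σ d) →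
    SatClause σ c

{-# OPTIONS --safe #-}
-- Backward direction: a model of ResCn(F) ∖ {c} satisfies the smaller clause c₁, or
-- both c₁ ∨ a and c₂ ∨ ¬a and hence c₁ or c₂.
--
-- Forward direction: up to set equality every derivable clause is a sublist of the
-- literals of F, so ResCn(F) is a computable finite list and both conditions are
-- decidable. If neither holds, the ordered model construction behind resolution
-- completeness yields a model of ResCn(F) ∖ {c} falsifying c: the variables of c are
-- set so as to falsify c, and every other variable n, in increasing order, is made
-- true exactly when some derivable clause contains the literal n and all its other
-- literals are already false. Take a falsified derivable d ≠ c whose largest variable
-- outside c is minimal. If there is no such variable then d ⊊ c. If the largest one,
-- n, occurs positively in d, then d itself would have made n true. If it occurs
-- negatively, resolving d with the clause that made n true gives a smaller falsified
-- clause, and that clause is not c because c is not a split on a variable outside c.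
module Submission where

open import Defs
open import Data.Bool using (Bool; true; false; T; not; if_then_else_)
open import Data.Empty using (⊥; ⊥-elim)
open import Data.List using (List; []; _∷_; _++_; map; filter; concat; length)
open import Data.List.Extrema.Nat using (max; xs≤max)
open import Data.List.Membership.Propositional using (_∈_; _∉_; find; lose)
open import Data.List.Membership.Propositional.Properties
  using (∈-++⁺ˡ; ∈-++⁺ʳ; ++-∈⇔; ∈-map⁺; ∈-filter⁺; ∈-filter⁻; ∈-concat⁺′)
open import Data.List.Relation.Binary.Subset.Propositional.Properties using (Any-resp-⊆)
open import Data.List.Relation.Unary.All as All using (All)
open import Data.List.Relation.Unary.Any as Any using (Any; here; there; any?)
open import Data.Nat using (ℕ; zero; suc; _<_; _≤_; z≤n; s≤s)
open import Data.Nat.Properties using (_≟_; _<?_; ≤-refl; ≤-pred; ≤∧≢⇒<; <-≤-trans; m≤n⇒m≤1+n)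
open import Data.Product using (_×_; ∃-syntax; _,_; proj₁; proj₂; uncurry)
open import Data.Product.Function.NonDependent.Propositional using (_×-⇔_)
open import Data.Sum using (_⊎_; inj₁; inj₂; [_,_])
open import Data.Sum.Function.Propositional using (_⊎-⇔_)
open import Function using (_∘_; id)
open import Function.Bundles using (_⇔_; mk⇔; Equivalence)
open import Function.Properties.Equivalence using ()
  renaming (refl to ⇔-refl; sym to ⇔-sym; trans to ⇔-trans)
open import Level using (0ℓ)
open import Relation.Binary.Definitions using (DecidableEquality)
open import Relation.Binary.PropositionalEquality using (_≡_; _≢_; refl; sym; trans; cong; subst)
open import Relation.Nullary using (¬_; Dec; yes; no; does; contradiction)
open import Relation.Nullary.Decidable
  using (map′; _×-dec_; _⊎-dec_; ¬?; T?; decidable-stable; isYes; toWitness; fromWitness)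
open import Relation.Unary using (Pred; Decidable)
open Equivalence using (to; from)

var : Lit → ℕ
var (pos a) = a
var (neg a) = a

var≡⇒ : ∀ l {n} → var l ≡ n → l ≡ pos n ⊎ l ≡ neg n
var≡⇒ (pos a) refl = inj₁ refl
var≡⇒ (neg a) refl = inj₂ refl

_≟ᴸ_ : DecidableEquality Lit
pos a ≟ᴸ pos b = map′ (cong pos) (λ { refl → refl }) (a ≟ b)
pos a ≟ᴸ neg b = no λ ()
neg a ≟ᴸ pos b = no λ ()
neg a ≟ᴸ neg b = map′ (cong neg) (λ { refl → refl }) (a ≟ b)

open import Data.List.Membership.DecPropositional _≟ᴸ_ using (_∈?_; _∉?_)
open import Data.List.Relation.Binary.Subset.DecPropositional _≟ᴸ_ using (_⊆?_)

occurs? : ∀ a c → Dec (Occurs a c)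
occurs? a c = pos a ∈? c ⊎-dec neg a ∈? c

occurs-var : ∀ {l c} → l ∈ c → Occurs (var l) c
occurs-var {pos a} = inj₁
occurs-var {neg a} = inj₂

≋-refl : ∀ {c} → c ≋ c
≋-refl _ = ⇔-refl

≋-sym : ∀ {c d} → c ≋ d → d ≋ c
≋-sym c≋d l = ⇔-sym (c≋d l)

≋-trans : ∀ {c d e} → c ≋ d → d ≋ e → c ≋ e
≋-trans c≋d d≋e l = ⇔-trans (c≋d l) (d≋e l)

≋⇒⊆ : ∀ {c d} → c ≋ d → c ⊆ d
≋⇒⊆ c≋d = to (c≋d _)

⊆-antisym : ∀ {c d} → c ⊆ d → d ⊆ c → c ≋ d
⊆-antisym c⊆d d⊆c _ = mk⇔ c⊆d d⊆c

_≋?_ : (c d : Clause) → Dec (c ≋ d)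
c ≋? d = map′ (uncurry ⊆-antisym) (λ c≋d → ≋⇒⊆ c≋d , ≋⇒⊆ (≋-sym c≋d)) (c ⊆? d ×-dec d ⊆? c)

⊆⇒⊊⊎≋ : ∀ {c d} → c ⊆ d → c ⊊ d ⊎ c ≋ d
⊆⇒⊊⊎≋ {c} {d} c⊆d with any? (_∉? c) d
... | yes missing = let l , l∈d , l∉c = find missing in inj₁ (c⊆d , l , l∈d , l∉c)
... | no none = inj₂ (⊆-antisym c⊆d λ l∈d → decidable-stable (_ ∈? c) (none ∘ lose l∈d))

_⊊?_ : (c d : Clause) → Dec (c ⊊ d)
c ⊊? d with c ⊆? d
... | no c⊈d = no λ c⊊d → c⊈d (proj₁ c⊊d)
... | yes c⊆d = [ yes , (λ c≋d → no λ (_ , l , l∈d , l∉c) → l∉c (from (c≋d l) l∈d)) ] (⊆⇒⊊⊎≋ c⊆d)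

⊊-respˡ-≋ : ∀ {c c′ d} → c ≋ c′ → c ⊊ d → c′ ⊊ d
⊊-respˡ-≋ c≋c′ (c⊆d , l , l∈d , l∉c) = c⊆d ∘ from (c≋c′ _) , l , l∈d , l∉c ∘ from (c≋c′ l)

tautology-resp-≋ : ∀ {c d} → c ≋ d → Tautology c → Tautology d
tautology-resp-≋ c≋d (a , p , n) = a , to (c≋d _) p , to (c≋d _) n

tautology? : (c : Clause) → Dec (Tautology c)
tautology? c = map′ fromAny toAny (any? clashes? c)
  where
  Clashes : Lit → Set
  Clashes l = ∃[ a ] (l ≡ pos a × neg a ∈ c)
  clashes? : (l : Lit) → Dec (Clashes l)
  clashes? (pos a) = map′ (λ n → a , refl , n) (λ { (_ , refl , n) → n }) (neg a ∈? c)
  clashes? (neg a) = no λ { (_ , () , _) }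
  fromAny : Any Clashes c → Tautology c
  fromAny clash with find clash
  ... | _ , p , a , refl , n = a , p , n
  toAny : Tautology c → Any Clashes c
  toAny (a , p , n) = lose p (a , refl , n)

satLit? : ∀ σ l → Dec (SatLit σ l)
satLit? σ (pos a) = T? (σ a)
satLit? σ (neg a) = T? (not (σ a))

satClause? : ∀ σ c → Dec (SatClause σ c)
satClause? σ = any? (satLit? σ)

satLit-agree : ∀ {σ τ} l → σ (var l) ≡ τ (var l) → SatLit σ l → SatLit τ l
satLit-agree (pos a) eq = subst T eq
satLit-agree (neg a) eq = subst (T ∘ not) eq

¬satLit-neg⇒satLit-pos : ∀ {σ} a → ¬ SatLit σ (neg a) → SatLit σ (pos a)
¬satLit-neg⇒satLit-pos {σ} a ¬sat with σ a
... | true = _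
... | false = ¬sat _

satLit-pos⇒¬satLit-neg : ∀ {σ} a → SatLit σ (pos a) → ¬ SatLit σ (neg a)
satLit-pos⇒¬satLit-neg {σ} a sat with σ a
... | true = λ ()

Falsifies : Assignment → Clause → Set
Falsifies σ c = ∀ {l} → l ∈ c → ¬ SatLit σ l

¬satClause⇒falsifies : ∀ {σ c} → ¬ SatClause σ c → Falsifies σ c
¬satClause⇒falsifies ¬sat l∈c = ¬sat ∘ lose l∈c

falsifies⇒¬satClause : ∀ {σ c} → Falsifies σ c → ¬ SatClause σ c
falsifies⇒¬satClause falsified sat = let _ , l∈c , satLit = find sat in falsified l∈c satLit

falsifies⇒nonTautological : ∀ {σ c} → Falsifies σ c → NonTautological c
falsifies⇒nonTautological {σ} falsified (a , p , n) =
  falsified p (¬satLit-neg⇒satLit-pos {σ} a (falsified n))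

falsifying : Clause → Assignment
falsifying c a = does (neg a ∈? c)

falsifying-falsifies : ∀ {c} → NonTautological c → Falsifies (falsifying c) c
falsifying-falsifies {c} nt {pos a} p sat with neg a ∈? c
... | yes n = nt (a , p , n)
falsifying-falsifies {c} nt {neg a} n sat with neg a ∈? c
... | no n∉c = n∉c n

falsifying-complete : ∀ {c} l → Occurs (var l) c → ¬ SatLit (falsifying c) l → l ∈ c
falsifying-complete {c} (pos a) occ ¬sat with neg a ∈? c | occ
... | yes _ | _ = ⊥-elim (¬sat _)
... | no _ | inj₁ p = p
... | no n∉c | inj₂ n = ⊥-elim (n∉c n)
falsifying-complete {c} (neg a) occ ¬sat with neg a ∈? c
... | yes n = n
... | no _ = ⊥-elim (¬sat _)

infixl 6 _without_
_without_ : Clause → Lit → Clause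
d without l = filter (λ m → ¬? (m ≟ᴸ l)) d

∈-without : ∀ d {l m} → m ∈ d without l ⇔ (m ∈ d × m ≢ l)
∈-without _ = mk⇔ (∈-filter⁻ _) (uncurry (∈-filter⁺ _))

∷-without-≋ : ∀ {d l} → l ∈ d → (l ∷ d without l) ≋ d
∷-without-≋ {d} {l} l∈d m = mk⇔ (λ { (here refl) → l∈d ; (there m∈) → proj₁ (to (∈-without d) m∈) }) keep
  where
  keep : m ∈ d → m ∈ l ∷ d without l
  keep m∈d with m ≟ᴸ l
  ... | yes refl = here refl
  ... | no m≢l = there (from (∈-without d) (m∈d , m≢l))

∷-minus-head : ∀ {x l : Lit} {xs} → x ∉ xs → (l ∈ x ∷ xs × l ≢ x) ⇔ l ∈ xs
∷-minus-head x∉xs = mk⇔ (λ { (here refl , l≢x) → ⊥-elim (l≢x refl) ; (there l∈xs , _) → l∈xs })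
                         (λ l∈xs → there l∈xs , λ { refl → x∉xs l∈xs })

resolvent : ℕ → Clause → Clause → Clause
resolvent a d₁ d₂ = d₁ without pos a ++ d₂ without neg a

IsResolvent : ℕ → Clause → Clause → Clause → Set
IsResolvent a d₁ d₂ d = ∀ l → (l ∈ d) ⇔ ((l ∈ d₁ × l ≢ pos a) ⊎ (l ∈ d₂ × l ≢ neg a))

resolvent-isResolvent : ∀ a d₁ d₂ → IsResolvent a d₁ d₂ (resolvent a d₁ d₂)
resolvent-isResolvent a d₁ d₂ l = ⇔-trans ++-∈⇔ (∈-without d₁ ⊎-⇔ ∈-without d₂)

isResolvent-resp-≋ : ∀ {a d₁ d₂ d e} → IsResolvent a d₁ d₂ d → d ≋ e → IsResolvent a d₁ d₂ e
isResolvent-resp-≋ r d≋e l = ⇔-trans (⇔-sym (d≋e l)) (r l)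

isResolvent-unique : ∀ {a d₁ d₂ d e₁ e₂ e} → IsResolvent a d₁ d₂ d → IsResolvent a e₁ e₂ e →
                     d₁ ≋ e₁ → d₂ ≋ e₂ → d ≋ e
isResolvent-unique r s d₁≋e₁ d₂≋e₂ l =
  ⇔-trans (r l) (⇔-trans ((d₁≋e₁ l ×-⇔ ⇔-refl) ⊎-⇔ (d₂≋e₂ l ×-⇔ ⇔-refl)) (⇔-sym (s l)))

isResolvent-split : ∀ {a c₁ c₂} → pos a ∉ c₁ → neg a ∉ c₂ →
                    IsResolvent a (pos a ∷ c₁) (neg a ∷ c₂) (c₁ ++ c₂)
isResolvent-split p∉c₁ n∉c₂ l = ⇔-trans ++-∈⇔ (⇔-sym (∷-minus-head p∉c₁ ⊎-⇔ ∷-minus-head n∉c₂))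

⊢-resp-≋ : ∀ {F d e} → F ⊢ d → d ≋ e → F ⊢ e
⊢-resp-≋ (axiom c∈F c≋d) d≋e = axiom c∈F (≋-trans c≋d d≋e)
⊢-resp-≋ (resolve a ⊢d₁ ⊢d₂ p n r nt) d≋e =
  resolve a ⊢d₁ ⊢d₂ p n (isResolvent-resp-≋ r d≋e) (nt ∘ tautology-resp-≋ (≋-sym d≋e))

⊢-resolvent : ∀ {F a d₁ d₂} → F ⊢ d₁ → F ⊢ d₂ → pos a ∈ d₁ → neg a ∈ d₂ →
              NonTautological (resolvent a d₁ d₂) → F ⊢ resolvent a d₁ d₂
⊢-resolvent {a = a} ⊢d₁ ⊢d₂ p n = resolve a ⊢d₁ ⊢d₂ p n (resolvent-isResolvent a _ _)

⊢⇒⊆concat : ∀ {F d} → F ⊢ d → d ⊆ concat F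
⊢⇒⊆concat (axiom c∈F c≋d) l∈d = ∈-concat⁺′ (from (c≋d _) l∈d) c∈F
⊢⇒⊆concat (resolve a ⊢d₁ ⊢d₂ p n r nt) l∈d =
  [ ⊢⇒⊆concat ⊢d₁ ∘ proj₁ , ⊢⇒⊆concat ⊢d₂ ∘ proj₁ ] (to (r _) l∈d)

sublists : ∀ {A : Set} → List A → List (List A)
sublists [] = [] ∷ []
sublists (x ∷ xs) = map (x ∷_) (sublists xs) ++ sublists xs

filter-∈-sublists : ∀ {A : Set} {P : Pred A 0ℓ} (P? : Decidable P) xs → filter P? xs ∈ sublists xs
filter-∈-sublists P? [] = here refl
filter-∈-sublists P? (x ∷ xs) with does (P? x)
... | true = ∈-++⁺ˡ (∈-map⁺ (x ∷_) (filter-∈-sublists P? xs))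
... | false = ∈-++⁺ʳ _ (filter-∈-sublists P? xs)

filter-∈-≋ : ∀ {d L} → d ⊆ L → filter (_∈? d) L ≋ d
filter-∈-≋ {d} {L} d⊆L _ =
  mk⇔ (proj₂ ∘ ∈-filter⁻ (_∈? d) {xs = L}) (λ l∈d → ∈-filter⁺ (_∈? d) (d⊆L l∈d) l∈d)

module _ {A : Set} {P Q : Pred A 0ℓ} (P? : Decidable P) (Q? : Decidable Q) (P⇒Q : ∀ {x} → P x → Q x) where

  length-filter-mono-≤ : ∀ xs → length (filter P? xs) ≤ length (filter Q? xs)
  length-filter-mono-≤ [] = z≤n
  length-filter-mono-≤ (x ∷ xs) with P? x | Q? x
  ... | yes _ | yes _ = s≤s (length-filter-mono-≤ xs)
  ... | yes p | no ¬q = contradiction (P⇒Q p) ¬q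
  ... | no _ | yes _ = m≤n⇒m≤1+n (length-filter-mono-≤ xs)
  ... | no _ | no _ = length-filter-mono-≤ xs

  length-filter-mono-< : ∀ {x xs} → x ∈ xs → Q x → ¬ P x → length (filter P? xs) < length (filter Q? xs)
  length-filter-mono-< {xs = y ∷ xs} (here refl) q ¬p with P? y | Q? y
  ... | yes p | _ = contradiction p ¬p
  ... | no _ | yes _ = s≤s (length-filter-mono-≤ xs)
  ... | no _ | no ¬q = contradiction q ¬q
  length-filter-mono-< {xs = y ∷ xs} (there x∈xs) q ¬p with P? y | Q? y
  ... | yes _ | yes _ = s≤s (length-filter-mono-< x∈xs q ¬p)
  ... | yes p | no ¬q = contradiction (P⇒Q p) ¬q
  ... | no _ | yes _ = m≤n⇒m≤1+n (length-filter-mono-< x∈xs q ¬p)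
  ... | no _ | no _ = length-filter-mono-< x∈xs q ¬p

record Saturation (F : CNF) : Set where
  field
    clauses : CNF
    sound : ∀ {e} → e ∈ clauses → F ⊢ e
    complete : ∀ {d} → F ⊢ d → ∃[ e ] (e ∈ clauses × e ≋ d)

module Saturate (F : CNF) where

  Covered : CNF → Clause → Set
  Covered C d = Any (_≋ d) C

  covered? : ∀ C d → Dec (Covered C d)
  covered? C d = any? (_≋? d) C

  Sound : CNF → Set
  Sound C = ∀ {e} → e ∈ C → F ⊢ e

  Closed : CNF → Set
  Closed C = ∀ {a e₁ e₂} → e₁ ∈ C → e₂ ∈ C → pos a ∈ e₁ → neg a ∈ e₂ →
             NonTautological (resolvent a e₁ e₂) → Covered C (resolvent a e₁ e₂)

  NewResolvent : CNF → Clause → Clause → Lit → Set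
  NewResolvent C e₁ e₂ (pos a) =
    neg a ∈ e₂ × NonTautological (resolvent a e₁ e₂) × ¬ Covered C (resolvent a e₁ e₂)
  NewResolvent C e₁ e₂ (neg a) = ⊥

  newResolvent? : ∀ C e₁ e₂ l → Dec (NewResolvent C e₁ e₂ l)
  newResolvent? C e₁ e₂ (pos a) = neg a ∈? e₂ ×-dec ¬? (tautology? _) ×-dec ¬? (covered? C _)
  newResolvent? C e₁ e₂ (neg a) = no λ ()

  closed-or-new : ∀ C → Sound C → Closed C ⊎ ∃[ d ] (F ⊢ d × ¬ Covered C d)
  closed-or-new C sound with any? (λ e₁ → any? (λ e₂ → any? (newResolvent? C e₁ e₂) e₁) C) C
  ... | no none = inj₁ λ e₁∈C e₂∈C p n nt →
    decidable-stable (covered? C _) λ new → none (lose e₁∈C (lose e₂∈C (lose p (n , nt , new))))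
  ... | yes some =
    let e₁ , e₁∈C , some₁ = find some
        e₂ , e₂∈C , some₂ = find some₁
        l , l∈e₁ , new = find some₂
    in inj₂ (derive e₁∈C e₂∈C l l∈e₁ new)
    where
    derive : ∀ {e₁ e₂} → e₁ ∈ C → e₂ ∈ C → ∀ l → l ∈ e₁ → NewResolvent C e₁ e₂ l →
             ∃[ d ] (F ⊢ d × ¬ Covered C d)
    derive e₁∈C e₂∈C (pos a) p (n , nt , new) = _ , ⊢-resolvent (sound e₁∈C) (sound e₂∈C) p n nt , new

  -- Every derivable clause is set-equal to a sublist of the literals of F,
  -- so saturation terminates once no such sublist is left uncovered.
  pending : CNF → List Clause
  pending C = filter (¬? ∘ covered? C) (sublists (concat F))

  pending-shrinks : ∀ {C d} → F ⊢ d → ¬ Covered C d → length (pending (d ∷ C)) < length (pending C)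
  pending-shrinks {C} {d} ⊢d new =
    length-filter-mono-< (¬? ∘ covered? (d ∷ C)) (¬? ∘ covered? C) (λ ¬cov cov → ¬cov (there cov))
      (filter-∈-sublists (_∈? d) (concat F))
      (new ∘ Any.map (λ e≋u → ≋-trans e≋u u≋d))
      (λ ¬cov → ¬cov (here (≋-sym u≋d)))
    where
    u≋d : filter (_∈? d) (concat F) ≋ d
    u≋d = filter-∈-≋ (⊢⇒⊆concat ⊢d)

  saturate : ∀ n C → length (pending C) < n → Sound C →
             ∃[ C′ ] ((∀ {e} → e ∈ C → e ∈ C′) × Sound C′ × Closed C′)
  saturate (suc n) C (s≤s bound) sound with closed-or-new C sound
  ... | inj₁ closed = C , id , sound , closed
  ... | inj₂ (d , ⊢d , new) =
    let C′ , C⊆C′ , sound′ , closed′ =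
          saturate n (d ∷ C) (<-≤-trans (pending-shrinks ⊢d new) bound)
            λ { (here refl) → ⊢d ; (there e∈C) → sound e∈C }
    in C′ , C⊆C′ ∘ there , sound′ , closed′

  saturation : Saturation F
  saturation with saturate (suc (length (pending F))) F ≤-refl (λ c∈F → axiom c∈F ≋-refl)
  ... | C , F⊆C , sound , closed = record { clauses = C ; sound = sound ; complete = complete }
    where
    complete : ∀ {d} → F ⊢ d → ∃[ e ] (e ∈ C × e ≋ d)
    complete (axiom c∈F c≋d) = _ , F⊆C c∈F , c≋d
    complete (resolve a ⊢d₁ ⊢d₂ p n r nt) =
      let e₁ , e₁∈C , e₁≋d₁ = complete ⊢d₁
          e₂ , e₂∈C , e₂≋d₂ = complete ⊢d₂
          res≋d = isResolvent-unique (resolvent-isResolvent a e₁ e₂) r e₁≋d₁ e₂≋d₂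
          e , e∈C , e≋res = find (closed e₁∈C e₂∈C (from (e₁≋d₁ _) p) (from (e₂≋d₂ _) n)
                                   (nt ∘ tautology-resp-≋ res≋d))
      in e , e∈C , ≋-trans e≋res res≋d

open Saturate using (saturation)

DerivableSubclause : CNF → Clause → Set
DerivableSubclause F c = ∃[ c₁ ] (c₁ ⊊ c × F ⊢ c₁)

DerivableSplit : CNF → Clause → Set
DerivableSplit F c = ∃[ a ] ∃[ c₁ ] ∃[ c₂ ]
  (¬ Occurs a c × c ≋ (c₁ ++ c₂) × F ⊢ (pos a ∷ c₁) × F ⊢ (neg a ∷ c₂))

subclause⇒superredundant : ∀ {F c} → DerivableSubclause F c → Superredundant F c
subclause⇒superredundant (c₁ , (c₁⊆c , l , l∈c , l∉c₁) , ⊢c₁) σ satisfied =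
  Any-resp-⊆ c₁⊆c (satisfied c₁ ⊢c₁ λ c₁≋c → l∉c₁ (from (c₁≋c l) l∈c))

split⇒superredundant : ∀ {F c} → DerivableSplit F c → Superredundant F c
split⇒superredundant (a , c₁ , c₂ , a∉c , c≋c₁c₂ , ⊢₁ , ⊢₂) σ satisfied
  with satisfied _ ⊢₁ (λ e → a∉c (inj₁ (to (e _) (here refl))))
     | satisfied _ ⊢₂ (λ e → a∉c (inj₂ (to (e _) (here refl))))
... | there sat₁ | _ = Any-resp-⊆ (from (c≋c₁c₂ _) ∘ ∈-++⁺ˡ) sat₁
... | here _ | there sat₂ = Any-resp-⊆ (from (c≋c₁c₂ _) ∘ ∈-++⁺ʳ c₁) sat₂
... | here satPos | here satNeg = ⊥-elim (satLit-pos⇒¬satLit-neg {σ} a satPos satNeg)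

resolvent⇒split : ∀ {F a c e₁ e₂} → F ⊢ e₁ → F ⊢ e₂ → pos a ∈ e₁ → neg a ∈ e₂ → ¬ Occurs a c →
                  resolvent a e₁ e₂ ≋ c → DerivableSplit F c
resolvent⇒split ⊢e₁ ⊢e₂ p n a∉c res≋c =
  _ , _ , _ , a∉c , ≋-sym res≋c ,
  ⊢-resp-≋ ⊢e₁ (≋-sym (∷-without-≋ p)) , ⊢-resp-≋ ⊢e₂ (≋-sym (∷-without-≋ n))

split⇒resolvent-≋ : ∀ {a c c₁ c₂ e₁ e₂} → ¬ Occurs a c → c ≋ (c₁ ++ c₂) →
                    (pos a ∷ c₁) ≋ e₁ → (neg a ∷ c₂) ≋ e₂ → resolvent a e₁ e₂ ≋ c
split⇒resolvent-≋ {a} {c₁ = c₁} {c₂} a∉c c≋c₁c₂ e₁≋ e₂≋ =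
  ≋-trans (isResolvent-unique (resolvent-isResolvent _ _ _) (isResolvent-split p∉c₁ n∉c₂)
                              (≋-sym e₁≋) (≋-sym e₂≋))
          (≋-sym c≋c₁c₂)
  where
  p∉c₁ : pos a ∉ c₁
  p∉c₁ p = a∉c (inj₁ (from (c≋c₁c₂ _) (∈-++⁺ˡ p)))
  n∉c₂ : neg a ∉ c₂
  n∉c₂ n = a∉c (inj₂ (from (c≋c₁c₂ _) (∈-++⁺ʳ c₁ n)))

module Decide {F : CNF} (S : Saturation F) (c : Clause) where
  open Saturation S

  derivableSubclause? : Dec (DerivableSubclause F c)
  derivableSubclause? = map′ fromAny toAny (any? (_⊊? c) clauses)
    where
    fromAny : Any (_⊊ c) clauses → DerivableSubclause F c
    fromAny some = let e , e∈C , e⊊c = find some in e , e⊊c , sound e∈C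
    toAny : DerivableSubclause F c → Any (_⊊ c) clauses
    toAny (d , d⊊c , ⊢d) = let e , e∈C , e≋d = complete ⊢d in lose e∈C (⊊-respˡ-≋ (≋-sym e≋d) d⊊c)

  SplitsOn : Clause → Clause → Lit → Set
  SplitsOn e₁ e₂ (pos a) = neg a ∈ e₂ × ¬ Occurs a c × resolvent a e₁ e₂ ≋ c
  SplitsOn e₁ e₂ (neg a) = ⊥

  splitsOn? : ∀ e₁ e₂ l → Dec (SplitsOn e₁ e₂ l)
  splitsOn? e₁ e₂ (pos a) = neg a ∈? e₂ ×-dec ¬? (occurs? a c) ×-dec resolvent a e₁ e₂ ≋? c
  splitsOn? e₁ e₂ (neg a) = no λ ()

  derivableSplit? : Dec (DerivableSplit F c)
  derivableSplit? =
    map′ fromAny toAny (any? (λ e₁ → any? (λ e₂ → any? (splitsOn? e₁ e₂) e₁) clauses) clauses)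
    where
    split : ∀ {e₁ e₂} → e₁ ∈ clauses → e₂ ∈ clauses → ∀ l → l ∈ e₁ → SplitsOn e₁ e₂ l → DerivableSplit F c
    split e₁∈C e₂∈C (pos a) p (n , a∉c , res≋c) = resolvent⇒split (sound e₁∈C) (sound e₂∈C) p n a∉c res≋c
    fromAny : Any (λ e₁ → Any (λ e₂ → Any (SplitsOn e₁ e₂) e₁) clauses) clauses → DerivableSplit F c
    fromAny some =
      let e₁ , e₁∈C , some₁ = find some
          e₂ , e₂∈C , some₂ = find some₁
          l , l∈e₁ , splits = find some₂
      in split e₁∈C e₂∈C l l∈e₁ splits
    toAny : DerivableSplit F c → Any (λ e₁ → Any (λ e₂ → Any (SplitsOn e₁ e₂) e₁) clauses) clauses
    toAny (a , c₁ , c₂ , a∉c , c≋c₁c₂ , ⊢₁ , ⊢₂) =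
      let e₁ , e₁∈C , e₁≋ = complete ⊢₁
          e₂ , e₂∈C , e₂≋ = complete ⊢₂
      in lose e₁∈C (lose e₂∈C (lose (from (e₁≋ _) (here refl))
           (from (e₂≋ _) (here refl) , a∉c , split⇒resolvent-≋ a∉c c≋c₁c₂ (≋-sym e₁≋) (≋-sym e₂≋))))

module Countermodel {F : CNF} (S : Saturation F) (c : Clause) where
  open Saturation S

  Decided : ℕ → ℕ → Set
  Decided n v = v < n ⊎ Occurs v c

  decided-suc : ∀ {n v} → Decided (suc n) v → v ≡ n ⊎ Decided n v
  decided-suc {n} {v} (inj₁ v<1+n) with v ≟ n
  ... | yes v≡n = inj₁ v≡n
  ... | no v≢n = inj₂ (inj₁ (≤∧≢⇒< (≤-pred v<1+n) v≢n))
  decided-suc (inj₂ occ) = inj₂ (inj₂ occ)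

  Produces : ℕ → Assignment → Clause → Set
  Produces n τ e = pos n ∈ e × All (λ l → l ≡ pos n ⊎ (Decided n (var l) × ¬ SatLit τ l)) e

  produces? : ∀ n τ e → Dec (Produces n τ e)
  produces? n τ e = pos n ∈? e ×-dec All.all? (λ l → l ≟ᴸ pos n ⊎-dec
                      ((var l <? n ⊎-dec occurs? (var l) c) ×-dec ¬? (satLit? τ l))) e

  value : ℕ → Assignment → Bool
  value n τ with occurs? n c
  ... | yes _ = falsifying c n
  ... | no _ = isYes (any? (produces? n τ) clauses)

  -- isYes rather than does keeps v ≟ n visible to with-abstraction in the lemmas below.
  approx : ℕ → Assignment
  approx zero = falsifying c
  approx (suc n) v = if isYes (v ≟ n) then value n (approx n) else approx n v

  σ : Assignment
  σ n = approx (suc n) n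

  σ-value : ∀ n → σ n ≡ value n (approx n)
  σ-value n with n ≟ n
  ... | yes _ = refl
  ... | no n≢n = contradiction refl n≢n

  approx-occurs : ∀ n {v} → Occurs v c → approx n v ≡ falsifying c v
  approx-occurs zero _ = refl
  approx-occurs (suc n) {v} occ with v ≟ n
  ... | no _ = approx-occurs n occ
  ... | yes refl with occurs? v c
  ...   | yes _ = refl
  ...   | no v∉c = contradiction occ v∉c

  approx-< : ∀ n {v} → v < n → approx n v ≡ σ v
  approx-< (suc n) {v} v<1+n with v ≟ n
  ... | yes refl = sym (σ-value v)
  ... | no v≢n = approx-< n (≤∧≢⇒< (≤-pred v<1+n) v≢n)

  approx-decided : ∀ n {v} → Decided n v → approx n v ≡ σ v
  approx-decided n (inj₁ v<n) = approx-< n v<n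
  approx-decided n (inj₂ occ) = trans (approx-occurs n occ) (sym (approx-occurs (suc _) occ))

  σ-fresh : ∀ {n} → ¬ Occurs n c → T (σ n) ⇔ Any (Produces n (approx n)) clauses
  σ-fresh {n} n∉c rewrite σ-value n with occurs? n c
  ... | yes occ = contradiction occ n∉c
  ... | no _ = mk⇔ toWitness fromWitness

  σ-falsifies : NonTautological c → Falsifies σ c
  σ-falsifies nt {l} l∈c =
    falsifying-falsifies nt l∈c ∘ satLit-agree l (approx-occurs (suc (var l)) (occurs-var l∈c))

  module _ (no-subclause : ¬ DerivableSubclause F c) (no-split : ¬ DerivableSplit F c) where

    Bounded : ℕ → Clause → Set
    Bounded n d = ∀ {l} → l ∈ d → Decided n (var l)

    SatisfiedUpTo : ℕ → Set
    SatisfiedUpTo n = ∀ {d} → F ⊢ d → ¬ d ≋ c → Bounded n d → ¬ Falsifies σ d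

    falsified-at : ∀ n {d l} → Falsifies σ d → l ∈ d → Decided n (var l) → ¬ SatLit (approx n) l
    falsified-at n {l = l} falsified l∈d decided =
      falsified l∈d ∘ satLit-agree l (approx-decided n decided)

    bounded-pred : ∀ {n d} → (∀ {l} → l ∈ d → var l ≡ n → Decided n (var l)) →
                   Bounded (suc n) d → Bounded n d
    bounded-pred at-n bounded l∈d = [ at-n l∈d , id ] (decided-suc (bounded l∈d))

    satisfiedUpTo-zero : SatisfiedUpTo 0
    satisfiedUpTo-zero {d} ⊢d d≉c bounded falsified =
      [ (λ d⊊c → no-subclause (d , d⊊c , ⊢d)) , d≉c ] (⊆⇒⊊⊎≋ d⊆c)
      where
      d⊆c : d ⊆ c
      d⊆c {l} l∈d with bounded l∈d
      ... | inj₂ occ = falsifying-complete l occ (falsified-at 0 falsified l∈d (inj₂ occ))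

    producer-of-falsified : ∀ {n d} → F ⊢ d → Bounded (suc n) d → Falsifies σ d → pos n ∈ d →
                            Any (Produces n (approx n)) clauses
    producer-of-falsified {n} {d} ⊢d bounded falsified p =
      let e , e∈C , e≋d = complete ⊢d
      in lose e∈C (from (e≋d _) p , All.tabulate (producing ∘ to (e≋d _)))
      where
      producing : ∀ {l} → l ∈ d → l ≡ pos n ⊎ (Decided n (var l) × ¬ SatLit (approx n) l)
      producing {l} l∈d with decided-suc (bounded l∈d)
      ... | inj₂ decided = inj₂ (decided , falsified-at n falsified l∈d decided)
      ... | inj₁ v≡n with var≡⇒ l v≡n
      ...   | inj₁ l≡pos = inj₁ l≡pos
      ...   | inj₂ refl = ⊥-elim (falsifies⇒nonTautological falsified (n , p , l∈d))

    resolve-with-producer : ∀ {n d} → ¬ Occurs n c → SatisfiedUpTo n → F ⊢ d → ¬ d ≋ c →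
                            Bounded (suc n) d → Falsifies σ d → neg n ∈ d → ⊥
    resolve-with-producer {n} {d} n∉c ih ⊢d d≉c bounded falsified q
      with find (to (σ-fresh n∉c) (¬satLit-neg⇒satLit-pos {σ} n (falsified q)))
    ... | e , e∈C , p , producing = ih ⊢r r≉c (proj₁ ∘ r-literal) (proj₂ ∘ r-literal)
      where
      r : Clause
      r = resolvent n e d

      from-producer : ∀ {l} → l ∈ e → l ≢ pos n → Decided n (var l) × ¬ SatLit σ l
      from-producer {l} l∈e l≢p with All.lookup producing l∈e
      ... | inj₁ l≡p = ⊥-elim (l≢p l≡p)
      ... | inj₂ (decided , ¬sat) = decided , ¬sat ∘ satLit-agree l (sym (approx-decided n decided))

      from-d : ∀ {l} → l ∈ d → l ≢ neg n → Decided n (var l) × ¬ SatLit σ l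
      from-d {l} l∈d l≢q with decided-suc (bounded l∈d)
      ... | inj₂ decided = decided , falsified l∈d
      ... | inj₁ v≡n = ⊥-elim ([ clash , l≢q ] (var≡⇒ l v≡n))
        where
        clash : l ≢ pos n
        clash refl = falsifies⇒nonTautological falsified (n , l∈d , q)

      r-literal : ∀ {l} → l ∈ r → Decided n (var l) × ¬ SatLit σ l
      r-literal {l} l∈r =
        [ uncurry from-producer , uncurry from-d ] (to (resolvent-isResolvent n e d l) l∈r)

      ⊢r : F ⊢ r
      ⊢r = ⊢-resolvent (sound e∈C) ⊢d p q (falsifies⇒nonTautological (proj₂ ∘ r-literal))

      r≉c : ¬ r ≋ c
      r≉c = no-split ∘ resolvent⇒split (sound e∈C) ⊢d p q n∉c

    satisfiedUpTo-suc : ∀ n → SatisfiedUpTo n → SatisfiedUpTo (suc n)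
    satisfiedUpTo-suc n ih {d} ⊢d d≉c bounded falsified with occurs? n c | pos n ∈? d | neg n ∈? d
    ... | yes n∈c | _ | _ = ih ⊢d d≉c (bounded-pred (λ _ v≡n → inj₂ (in-c v≡n)) bounded) falsified
      where
      in-c : ∀ {v} → v ≡ n → Occurs v c
      in-c refl = n∈c
    ... | no n∉c | yes p | _ =
      falsified p (from (σ-fresh n∉c) (producer-of-falsified ⊢d bounded falsified p))
    ... | no n∉c | no _ | yes q = resolve-with-producer n∉c ih ⊢d d≉c bounded falsified q
    ... | no _ | no p∉d | no q∉d = ih ⊢d d≉c (bounded-pred absent bounded) falsified
      where
      absent : ∀ {l} → l ∈ d → var l ≡ n → Decided n (var l)
      absent {l} l∈d v≡n with var≡⇒ l v≡n
      ... | inj₁ refl = ⊥-elim (p∉d l∈d)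
      ... | inj₂ refl = ⊥-elim (q∉d l∈d)

    satisfiedUpTo : ∀ n → SatisfiedUpTo n
    satisfiedUpTo zero = satisfiedUpTo-zero
    satisfiedUpTo (suc n) = satisfiedUpTo-suc n (satisfiedUpTo n)

    σ-satisfies : ∀ {d} → F ⊢ d → ¬ d ≋ c → SatClause σ d
    σ-satisfies {d} ⊢d d≉c = decidable-stable (satClause? σ d) λ ¬sat →
      satisfiedUpTo (suc (max 0 (map var d))) ⊢d d≉c bounded (¬satClause⇒falsifies ¬sat)
      where
      bounded : Bounded (suc (max 0 (map var d))) d
      bounded l∈d = inj₁ (s≤s (All.lookup (xs≤max 0 (map var d)) (∈-map⁺ var l∈d)))

superredundant⇒subclause⊎split : ∀ {F c} → All NonTautological F → c ∈ F → Superredundant F c →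
                                 DerivableSubclause F c ⊎ DerivableSplit F c
superredundant⇒subclause⊎split {F} {c} ntF c∈F superredundant
  with Decide.derivableSubclause? (saturation F) c | Decide.derivableSplit? (saturation F) c
... | yes subclause | _ = inj₁ subclause
... | no _ | yes split = inj₂ split
... | no ¬subclause | no ¬split =
  ⊥-elim (falsifies⇒¬satClause (σ-falsifies (All.lookup ntF c∈F))
           (superredundant σ λ _ → σ-satisfies ¬subclause ¬split))
  where open Countermodel (saturation F) c

lemma7 : (F : CNF) (c : Clause) →
         All NonTautological F →
         c ∈ F →
         Superredundant F c ⇔
           ((∃[ c₁ ] (c₁ ⊊ c × F ⊢ c₁))
           ⊎ (∃[ a ] ∃[ c₁ ] ∃[ c₂ ]
                (¬ Occurs a c × c ≋ (c₁ ++ c₂) × F ⊢ (pos a ∷ c₁) × F ⊢ (neg a ∷ c₂))))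
lemma7 F c ntF c∈F =
  mk⇔ (superredundant⇒subclause⊎split ntF c∈F) [ subclause⇒superredundant , split⇒superredundant ]
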